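{- Let $k\geq 1$. Then $\liminf_{n\to\infty}\tau(\Gamma_{n,k})\geq\frac{k+5}{2(k+6)}$.
   Context: For a pure complex $\Delta$, $T(\Delta)$ is the minimum size of a set of vertices meeting every facet and $\tau(\Delta)=T(\Delta)/(\text{number of vertices})$. For a finite set $V$, $\overline V$ is the simplex of all subsets of $V$ and $\partial\overline V=\overline V\setminus\{V\}$; $\Delta*\Gamma=\{F\cup G:F\in\Delta,G\in\Gamma\}$; $\mathrm{st}(F,\Delta)=\{G\in\Delta: F\cup G\in\Delta\}$. Let $D(n,4)$ (for $n\ge6$) be the boundary complex (generated by the $3$-faces lying in exactly one facet) of the pure $4$-dimensional complex on $[n]$ generated by all sets $\{a,a+1,b,b+1,b+2\}$ with $1\le a$, $a+1<b$, $b+2\le n$. Define $\Gamma_{n,0}=D(n,4)$ and recursively, for $k\ge0$: if for all $k+2\le i\le n-5$ the set $\{i-k-1,i+1,i+5\}$ is not a face of $\Gamma_{n,k}$, $\{i-k,i+2,i+4\}$ is a face, and $\mathrm{st}(\{i-k,i+2,i+4\},\Gamma_{n,k})=\overline{\{i-k,i+2,i+4\}}*\partial\overline{\{i-k-1,i+1,i+5\}}$, then $\Gamma_{n,k+1}$ is obtained by simultaneously replacing, for all such $i$, $\overline{\{i-k,i+2,i+4\}}*\partial\overline{\{i-k-1,i+1,i+5\}}$ by $\partial\overline{\{i-k,i+2,i+4\}}*\overline{\{i-k-1,i+1,i+5\}}$ (bistellar flips). These conditions hold for all $0\le k\le n-6$, so $\Gamma_{n,k}$ is defined for $n\ge k+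6$.
   Formalization: D(n,4) is generated by the 4-faces lying in exactly one facet of the pure 5-dimensional complex generated by all {a,a+1,b,b+1,b+2,b+3} with b+3 ≤ n, instead of 3-faces and {a,a+1,b,b+1,b+2}. The paper assumes this as well. -}

module Defs where

open import Data.Bool using (Bool; true; false; _∧_; _∨_; not; if_then_else_)
open import Data.Nat using (ℕ; zero; suc; _+_; _*_; _∸_; _≡ᵇ_; _⊓_)
open import Data.Bool.ListAction using (all; any)
open import Data.List using (List; []; _∷_; map; concatMap; filter; length; upTo; foldr; _++_; concat; deduplicateᵇ; filterᵇ)
open import Data.Integer using (+_)
open import Data.Rational using (ℚ; 0ℚ; _/_)

-- Finite sets of vertices (vertices are natural numbers) are lists,
-- compared as sets.  A pure complex is given by the list of its facets.
VSet : Set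
VSet = List ℕ

Complex : Set
Complex = List VSet

_∈ᵇ_ : ℕ → VSet → Bool
x ∈ᵇ ys = any (x ≡ᵇ_) ys

_⊆ᵇ_ : VSet → VSet → Bool
xs ⊆ᵇ ys = all (_∈ᵇ ys) xs

_≈ᵇ_ : VSet → VSet → Bool
xs ≈ᵇ ys = (xs ⊆ᵇ ys) ∧ (ys ⊆ᵇ xs)

_∈ˢ_ : VSet → List VSet → Bool
S ∈ˢ Fs = any (S ≈ᵇ_) Fs

sameFamily : List VSet → List VSet → Bool
sameFamily Fs Gs = all (_∈ˢ Gs) Fs ∧ all (_∈ˢ Fs) Gs

-- the integers lo, lo+1, ..., hi  (empty if hi < lo)
between : ℕ → ℕ → List ℕ
between lo hi = map (λ j → lo + j) (upTo (suc hi ∸ lo))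

remove : ℕ → VSet → VSet
remove x = filterᵇ (λ y → not (y ≡ᵇ x))

ballFacets : ℕ → Complex
ballFacets n =
  concatMap (λ a → map (λ b → a ∷ suc a ∷ b ∷ suc b ∷ (b + 2) ∷ (b + 3) ∷ [])
                       (between (a + 2) (n ∸ 3)))
            (between 1 n)

count : VSet → Complex → ℕ
count S K = length (filterᵇ (S ⊆ᵇ_) K)

ridges : VSet → List VSet
ridges F = map (λ x → remove x F) F

D4 : ℕ → Complex
D4 n = filterᵇ (λ S → count S K ≡ᵇ 1) (concatMap ridges K)
  where K = ballFacets n

starFacets : VSet → Complex → Complex
starFacets A Δ = filterᵇ (A ⊆ᵇ_) Δ

isFace : VSet → Complex → Bool
isFace A Δ = any (A ⊆ᵇ_) Δ

joinBdry : VSet → VSet → Complex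
joinBdry A B = map (λ b → A ++ remove b B) B

Aset Bset : ℕ → ℕ → VSet
Aset k i = (i ∸ k) ∷ (i + 2) ∷ (i + 4) ∷ []
Bset k i = (i ∸ (k + 1)) ∷ (i + 1) ∷ (i + 5) ∷ []

flipCond : ℕ → Complex → ℕ → Bool
flipCond k Δ i =
  not (isFace (Bset k i) Δ) ∧ isFace (Aset k i) Δ
  ∧ sameFamily (starFacets (Aset k i) Δ) (joinBdry (Aset k i) (Bset k i))

indices : ℕ → ℕ → List ℕ
indices n k = between (k + 2) (n ∸ 5)

-- simultaneous bistellar flips for all admissible i; if the conditions
-- fail (which by the paper never happens for n ≥ k+6) nothing is changed
flipStep : ℕ → ℕ → Complex → Complex
flipStep n k Δ =
  if all (flipCond k Δ) (indices n k)
  then filterᵇ (λ F → not (F ∈ˢ old)) Δ ++ new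
  else Δ
  where
  old = concatMap (λ i → joinBdry (Aset k i) (Bset k i)) (indices n k)
  new = concatMap (λ i → joinBdry (Bset k i) (Aset k i)) (indices n k)

Γ : ℕ → ℕ → Complex
Γ n zero    = D4 n
Γ n (suc k) = flipStep n k (Γ n k)

vertices : Complex → VSet
vertices Δ = deduplicateᵇ _≡ᵇ_ (concat Δ)

subsets : VSet → List VSet
subsets []       = [] ∷ []
subsets (x ∷ xs) = subsets xs ++ map (x ∷_) (subsets xs)

meetsAll : VSet → Complex → Bool
meetsAll S Δ = all (λ F → any (_∈ᵇ S) F) Δ

T : Complex → ℕ
T Δ = foldr _⊓_ (length V) (map length (filterᵇ (λ S → meetsAll S Δ) (subsets V)))
  where V = vertices Δ

-- ratio of naturals as a rational (0 if the denominator is 0)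
frac : ℕ → ℕ → ℚ
frac t zero    = 0ℚ
frac t (suc m) = (+ t) / suc m

τ : Complex → ℚ
τ Δ = frac (T Δ) (length (vertices Δ))

{-# OPTIONS --termination-depth=8 #-}
-- Facets of D4 n whose vertex span exceeds k + 5 are never touched by the flips of the first k steps
-- (a flip at step j only affects a window of width j + 6), so for k ≥ 1 the complex Γ n k contains the
-- ridges {a, a+1, b, b+1, b+3} and {a, a+1, b, b+2, b+3} whenever b ≥ a + k + 3; it also contains the
-- facets {t, t+1, t+2, t+5, t+6} created by the first flip.  Mark the vertices of [1, n] missed by a
-- transversal S with 1 and the others with 0.  Up to the first pair of adjacent ones, at a and a + 1, no
-- two ones are adjacent; from a + k + 3 on the word avoids the patterns 11·1, 1·11 and 111··11, and such
-- a word has at most six more ones than zeros.  Hence n ≤ 2|S| + k + 9, and since Γ n k has at most n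
-- vertices, τ (Γ n k) ≥ (n − k − 9) / 2n, which exceeds (k + 5) / (2(k + 6)) for large n.
module Submission where

module Combinatorics where

  open import Data.Bool using (Bool; true; false; not; _∧_; _∨_; T?; if_then_else_) renaming (T to IsTrue)
  open import Data.Bool.Properties using (T-∧; T-≡; not-involutive)
  open import Data.Bool.ListAction using (all)
  open import Data.Empty using (⊥; ⊥-elim)
  open import Data.List using ([]; _∷_; map; concatMap; concat; filter; filterᵇ; length; _++_; foldr; deduplicateᵇ)
  open import Data.List.Properties using (map-++; map-cong; map-∘; filter-all)
  open import Data.List.Membership.Propositional using (_∈_; find; lose)
  open import Data.List.Membership.Propositional.Properties
    using (∈-map⁺; ∈-map⁻; ∈-filter⁺; ∈-filter⁻; ∈-upTo⁺; ∈-upTo⁻; ∈-concatMap⁺; ∈-concatMap⁻;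
           ∈-++⁺ˡ; ∈-++⁺ʳ; ∈-++⁻; ∈-concat⁺′; ∈-concat⁻′; foldr-selective)
  open import Data.List.Relation.Binary.Subset.Propositional using (_⊆_)
  open import Data.List.Relation.Unary.All as All using (_∷_)
  open import Data.List.Relation.Unary.All.Properties using (all⁺; all⁻)
  open import Data.List.Relation.Unary.Any as Any using (here; there)
  open import Data.List.Relation.Unary.Any.Properties using (any⁺; any⁻; deduplicate⁺; deduplicate⁻)
  open import Data.List.Relation.Unary.AllPairs as AllPairs using ([]; _∷_)
  import Data.List.Relation.Unary.AllPairs.Properties as AllPairsₚ
  import Data.List.Relation.Unary.All.Properties as Allₚ
  open import Data.List.Relation.Unary.Unique.Propositional using (Unique)
  import Data.List.Relation.Unary.Unique.Propositional.Properties as Uniqueₚ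
  open import Data.List.Relation.Binary.Disjoint.Propositional using (Disjoint)
  open import Data.Nat using (ℕ; zero; suc; _+_; _*_; _∸_; _≤_; _<_; z≤n; s≤s; _≡ᵇ_; _≤ᵇ_; _<ᵇ_; _≤?_; _≟_; _⊓_)
  open import Data.Nat.Properties
  open import Data.Nat.Solver using (module +-*-Solver)
  open import Data.Product using (∃-syntax; _×_; _,_; proj₁; proj₂)
  open import Data.Sum using (_⊎_; inj₁; inj₂; swap)
  open import Function using (_∘_; _∘₂_; Equivalence)
  open import Relation.Binary.PropositionalEquality
  open import Relation.Nullary using (¬_; ¬?; contradiction; yes; no)
  open import Defs

  T-not⁻ : ∀ {b} → IsTrue (not b) → ¬ IsTrue b
  T-not⁻ {false} _ ()

  T-not⁺ : ∀ {b} → ¬ IsTrue b → IsTrue (not b)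
  T-not⁺ {true}  ¬b = ¬b _
  T-not⁺ {false} _  = _

  ∈ᵇ⇒∈ : ∀ {x} ys → IsTrue (x ∈ᵇ ys) → x ∈ ys
  ∈ᵇ⇒∈ {x} ys = Any.map (≡ᵇ⇒≡ x _) ∘ any⁻ (x ≡ᵇ_) ys

  ∈⇒∈ᵇ : ∀ {x ys} → x ∈ ys → IsTrue (x ∈ᵇ ys)
  ∈⇒∈ᵇ {x} = any⁺ (x ≡ᵇ_) ∘ Any.map (≡⇒≡ᵇ x _)

  ⊆ᵇ⇒⊆ : ∀ xs {ys} → IsTrue (xs ⊆ᵇ ys) → xs ⊆ ys
  ⊆ᵇ⇒⊆ xs {ys} h = ∈ᵇ⇒∈ ys ∘ All.lookup (all⁺ (_∈ᵇ ys) xs h)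

  ⊆⇒⊆ᵇ : ∀ {xs ys} → xs ⊆ ys → IsTrue (xs ⊆ᵇ ys)
  ⊆⇒⊆ᵇ {ys = ys} h = all⁻ (_∈ᵇ ys) (All.tabulate (∈⇒∈ᵇ ∘ h))

  ∈ˢ⇒⊆ : ∀ S Fs → IsTrue (S ∈ˢ Fs) → ∃[ F ] F ∈ Fs × S ⊆ F × F ⊆ S
  ∈ˢ⇒⊆ S Fs h with F , F∈Fs , S≈F ← find (any⁻ (S ≈ᵇ_) Fs h)
    with S⊆F , F⊆S ← Equivalence.to T-∧ S≈F = F , F∈Fs , ⊆ᵇ⇒⊆ S S⊆F , ⊆ᵇ⇒⊆ F F⊆S

  isFace⇒⊆ : ∀ A Δ → IsTrue (isFace A Δ) → ∃[ F ] F ∈ Δ × A ⊆ F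
  isFace⇒⊆ A Δ h with F , F∈Δ , A⊆F ← find (any⁻ (A ⊆ᵇ_) Δ h) = F , F∈Δ , ⊆ᵇ⇒⊆ A A⊆F

  ∈-remove⁻ : ∀ x F {y} → y ∈ remove x F → y ∈ F × y ≢ x
  ∈-remove⁻ x F {y} y∈ with y∈F , y≠x ← ∈-filter⁻ (T? ∘ λ y → not (y ≡ᵇ x)) {xs = F} y∈ =
    y∈F , T-not⁻ y≠x ∘ ≡⇒≡ᵇ y x

  ∈-remove⁺ : ∀ x {F y} → y ∈ F → y ≢ x → y ∈ remove x F
  ∈-remove⁺ x {y = y} y∈F y≢x = ∈-filter⁺ (T? ∘ λ y → not (y ≡ᵇ x)) y∈F (T-not⁺ (y≢x ∘ ≡ᵇ⇒≡ y x))

  0<∸⇒< : ∀ {n o} → 0 < n ∸ o → o < n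
  0<∸⇒< = m∸n≢0⇒n<m ∘ n>0⇒n≢0

  ∈-between⁻ : ∀ lo hi {y} → y ∈ between lo hi → lo ≤ y × y ≤ hi
  ∈-between⁻ lo hi y∈ with j , j∈ , refl ← ∈-map⁻ (lo +_) y∈ =
    m≤m+n lo j , subst (_≤ hi) (+-comm j lo) (≤-pred (m≤o∸n⇒m+n≤o (suc j) lo≤1+hi j<))
    where
    j< = ∈-upTo⁻ j∈
    lo≤1+hi : lo ≤ suc hi
    lo≤1+hi = <⇒≤ (0<∸⇒< (≤-trans (s≤s z≤n) j<))

  ∈-between⁺ : ∀ lo hi {y} → lo ≤ y → y ≤ hi → y ∈ between lo hi
  ∈-between⁺ lo hi {y} lo≤y y≤hi = subst (_∈ between lo hi) (m+[n∸m]≡n lo≤y)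
    (∈-map⁺ (lo +_) (∈-upTo⁺ (m+n≤o⇒m≤o∸n (suc (y ∸ lo)) (s≤s (subst (_≤ hi) (sym (m∸n+n≡m lo≤y)) y≤hi)))))

  unique-constant⇒length≡1 : ∀ {A : Set} {x : A} {ys} → Unique ys → x ∈ ys → (∀ {y} → y ∈ ys → y ≡ x) →
    length ys ≡ 1
  unique-constant⇒length≡1 {ys = _ ∷ []} _ _ _ = refl
  unique-constant⇒length≡1 {ys = _ ∷ _ ∷ _} ((y≢z ∷ _) ∷ _) _ ≡x =
    contradiction (trans (≡x (here refl)) (sym (≡x (there (here refl))))) y≢z

  distinct⇒2≤length : ∀ {A : Set} {x y : A} {ys} → x ∈ ys → y ∈ ys → x ≢ y → 2 ≤ length ys
  distinct⇒2≤length {ys = _ ∷ _ ∷ _} _ _ _ = s≤s (s≤s z≤n)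
  distinct⇒2≤length {ys = _ ∷ []} (here refl) (here refl) x≢y = contradiction refl x≢y
  distinct⇒2≤length {ys = _ ∷ []} (there ()) _ _
  distinct⇒2≤length {ys = _ ∷ []} _ (there ()) _

  deduplicateᵇ-unique : ∀ xs → Unique (deduplicateᵇ _≡ᵇ_ xs)
  deduplicateᵇ-unique [] = []
  deduplicateᵇ-unique (x ∷ xs) =
    All.map (λ x≢ᵇy x≡y → x≢ᵇy (≡⇒≡ᵇ _ _ x≡y))
      (Allₚ.all-filter (¬? ∘ T? ∘ (x ≡ᵇ_)) (deduplicateᵇ _≡ᵇ_ xs))
    ∷ AllPairsₚ.filter⁺ (¬? ∘ T? ∘ (x ≡ᵇ_)) (deduplicateᵇ-unique xs)

  length-≤-filter-≢ : ∀ c ys → Unique ys → length ys ≤ suc (length (filter (¬? ∘ (_≟ c)) ys))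
  length-≤-filter-≢ c [] _ = z≤n
  length-≤-filter-≢ c (y ∷ ys) (y∉ys ∷ ys!) with y ≡ᵇ c in y≡ᵇc
  ... | false = s≤s (length-≤-filter-≢ c ys ys!)
  ... | true = s≤s (≤-reflexive (sym (cong length (filter-all (¬? ∘ (_≟ c)) (All.map ≢c y∉ys)))))
    where
    ≢c : ∀ {z} → y ≢ z → z ≢ c
    ≢c y≢z z≡c = y≢z (trans (≡ᵇ⇒≡ y c (Equivalence.from T-≡ y≡ᵇc)) (sym z≡c))

  unique-bounded⇒length≤ : ∀ n ys → Unique ys → (∀ {y} → y ∈ ys → 1 ≤ y × y ≤ n) → length ys ≤ n
  unique-bounded⇒length≤ zero [] _ _ = z≤n
  unique-bounded⇒length≤ zero (_ ∷ _) _ range =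
    contradiction (≤-trans (proj₁ (range (here refl))) (proj₂ (range (here refl)))) λ ()
  unique-bounded⇒length≤ (suc n) ys ys! range = ≤-trans (length-≤-filter-≢ (suc n) ys ys!)
    (s≤s (unique-bounded⇒length≤ n _ (Uniqueₚ.filter⁺ (¬? ∘ (_≟ suc n)) ys!) range′))
    where
    range′ : ∀ {y} → y ∈ filter (¬? ∘ (_≟ suc n)) ys → 1 ≤ y × y ≤ n
    range′ y∈ with y∈ys , y≢ ← ∈-filter⁻ (¬? ∘ (_≟ suc n)) {xs = ys} y∈ =
      proj₁ (range y∈ys) , ≤-pred (≤∧≢⇒< (proj₂ (range y∈ys)) y≢)

  foldr-⊓-≤ : ∀ i xs → foldr _⊓_ i xs ≤ i
  foldr-⊓-≤ i [] = ≤-refl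
  foldr-⊓-≤ i (x ∷ xs) = ≤-trans (m⊓n≤n x _) (foldr-⊓-≤ i xs)

  ballFacet : ℕ → ℕ → VSet
  ballFacet a b = a ∷ suc a ∷ b ∷ suc b ∷ (b + 2) ∷ (b + 3) ∷ []

  Admissible : ℕ → ℕ → ℕ → Set
  Admissible n a b = 1 ≤ a × 2 + a ≤ b × 3 + b ≤ n

  data BallVertex (a b : ℕ) : ℕ → Set where
    a₀ : BallVertex a b a
    a₁ : BallVertex a b (1 + a)
    b₀ : BallVertex a b b
    b₁ : BallVertex a b (1 + b)
    b₂ : BallVertex a b (2 + b)
    b₃ : BallVertex a b (3 + b)

  ballVertex : ∀ {a b y} → y ∈ ballFacet a b → BallVertex a b y
  ballVertex (here refl) = a₀
  ballVertex (there (here refl)) = a₁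
  ballVertex (there (there (here refl))) = b₀
  ballVertex (there (there (there (here refl)))) = b₁
  ballVertex {b = b} (there (there (there (there (here refl))))) rewrite +-comm b 2 = b₂
  ballVertex {b = b} (there (there (there (there (there (here refl)))))) rewrite +-comm b 3 = b₃

  ∈-ballFacet : ∀ {a b y} → BallVertex a b y → y ∈ ballFacet a b
  ∈-ballFacet a₀ = here refl
  ∈-ballFacet a₁ = there (here refl)
  ∈-ballFacet b₀ = there (there (here refl))
  ∈-ballFacet b₁ = there (there (there (here refl)))
  ∈-ballFacet {a} {b} b₂ = subst (_∈ ballFacet a b) (+-comm b 2) (there (there (there (there (here refl)))))
  ∈-ballFacet {a} {b} b₃ = subst (_∈ ballFacet a b) (+-comm b 3) (there (there (there (there (there (here refl))))))

  ballFacet-injective : ∀ {a b a′ b′} → ballFacet a b ≡ ballFacet a′ b′ → a ≡ a′ × b ≡ b′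
  ballFacet-injective refl = refl , refl

  module _ {a b : ℕ} (2+a≤b : 2 + a ≤ b) where

    ballVertex-≥ : ∀ {y} → BallVertex a b y → a ≤ y
    ballVertex-≥ a₀ = ≤-refl
    ballVertex-≥ a₁ = n≤1+n a
    ballVertex-≥ b₀ = ≤-trans (m≤n+m a 2) 2+a≤b
    ballVertex-≥ b₁ = ≤-trans (m≤n+m a 2) (m≤n⇒m≤1+n 2+a≤b)
    ballVertex-≥ b₂ = ≤-trans (m≤n+m a 2) (≤-trans 2+a≤b (m≤n+m b 2))
    ballVertex-≥ b₃ = ≤-trans (m≤n+m a 2) (≤-trans 2+a≤b (m≤n+m b 3))

    ballVertex-≤ : ∀ {y} → BallVertex a b y → y ≤ 3 + b
    ballVertex-≤ a₀ = ≤-trans (m≤n+m a 2) (≤-trans 2+a≤b (m≤n+m b 3))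
    ballVertex-≤ a₁ = ≤-trans (m≤n+m (1 + a) 1) (≤-trans 2+a≤b (m≤n+m b 3))
    ballVertex-≤ b₀ = m≤n+m b 3
    ballVertex-≤ b₁ = s≤s (m≤n+m b 2)
    ballVertex-≤ b₂ = s≤s (s≤s (m≤n+m b 1))
    ballVertex-≤ b₃ = ≤-refl

    ballVertex-<b : ∀ {y} → BallVertex a b y → y < b → y ≤ 1 + a
    ballVertex-<b a₀ _ = n≤1+n a
    ballVertex-<b a₁ _ = ≤-refl
    ballVertex-<b b₀ b<b = contradiction b<b (n≮n b)
    ballVertex-<b b₁ 1+b<b = contradiction (≤-trans (n≤1+n _) 1+b<b) (n≮n b)
    ballVertex-<b b₂ 2+b<b = contradiction (≤-trans (m≤n+m _ 2) 2+b<b) (n≮n b)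
    ballVertex-<b b₃ 3+b<b = contradiction (≤-trans (m≤n+m _ 3) 3+b<b) (n≮n b)

  ballFacet-determined : ∀ {a b a′ b′} → 2 + a ≤ b → 2 + a′ ≤ b′ →
    BallVertex a′ b′ a → BallVertex a′ b′ (1 + a) → BallVertex a′ b′ b → BallVertex a′ b′ (3 + b) →
    a ≡ a′ × b ≡ b′
  ballFacet-determined {a} {b} {a′} {b′} 2+a≤b 2+a′≤b′ va va₁ vb vb₃ = a≡a′ , b≡b′
    where
    a′≤a : a′ ≤ a
    a′≤a = ballVertex-≥ 2+a′≤b′ va
    b≮b′ : ¬ b < b′
    b≮b′ b<b′ = 1+n≰n (≤-trans 2+a≤b (≤-trans (ballVertex-<b 2+a′≤b′ vb b<b′) (s≤s a′≤a)))
    b≡b′ : b ≡ b′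
    b≡b′ = ≤-antisym (+-cancelˡ-≤ 3 b b′ (ballVertex-≤ 2+a′≤b′ vb₃)) (≮⇒≥ b≮b′)
    a≡a′ : a ≡ a′
    a≡a′ = ≤-antisym (≤-pred (ballVertex-<b 2+a′≤b′ va₁ (subst (1 + a <_) b≡b′ 2+a≤b))) a′≤a

  ∈-ballFacets⁻ : ∀ {n F} → F ∈ ballFacets n → ∃[ a ] ∃[ b ] Admissible n a b × F ≡ ballFacet a b
  ∈-ballFacets⁻ {n} F∈
    with a , a∈ , F∈′ ← find (∈-concatMap⁻ (λ a → map (ballFacet a) (between (a + 2) (n ∸ 3))) {xs = between 1 n} F∈)
    with b , b∈ , refl ← ∈-map⁻ (ballFacet a) F∈′ =
    a , b , (1≤a , 2+a≤b , 3+b≤n) , refl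
    where
    1≤a : 1 ≤ a
    1≤a = proj₁ (∈-between⁻ 1 n a∈)
    2+a≤b : 2 + a ≤ b
    2+a≤b = subst (_≤ b) (+-comm a 2) (proj₁ (∈-between⁻ (a + 2) (n ∸ 3) b∈))
    b≤n∸3 : b ≤ n ∸ 3
    b≤n∸3 = proj₂ (∈-between⁻ (a + 2) (n ∸ 3) b∈)
    3+b≤n : 3 + b ≤ n
    3+b≤n = subst (_≤ n) (+-comm b 3) (m≤o∸n⇒m+n≤o b 3≤n b≤n∸3)
      where
      3≤n : 3 ≤ n
      3≤n = <⇒≤ (0<∸⇒< (≤-trans (≤-trans (s≤s z≤n) 2+a≤b) b≤n∸3))

  ∈-ballFacets⁺ : ∀ {n a b} → Admissible n a b → ballFacet a b ∈ ballFacets n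
  ∈-ballFacets⁺ {n} {a} {b} (1≤a , 2+a≤b , 3+b≤n) =
    ∈-concatMap⁺ (λ a → map (ballFacet a) (between (a + 2) (n ∸ 3)))
      (lose (∈-between⁺ 1 n 1≤a a≤n) (∈-map⁺ (ballFacet a) b∈))
    where
    b≤n∸3 = m+n≤o⇒m≤o∸n b (subst (_≤ n) (+-comm 3 b) 3+b≤n)
    a≤n = ≤-trans (m≤n+m a 2) (≤-trans 2+a≤b (≤-trans (m≤n+m b 3) 3+b≤n))
    b∈ = ∈-between⁺ (a + 2) (n ∸ 3) (subst (_≤ b) (+-comm 2 a) 2+a≤b) b≤n∸3

  between-unique : ∀ lo hi → Unique (between lo hi)
  between-unique lo hi = Uniqueₚ.map⁺ (+-cancelˡ-≡ lo _ _) (Uniqueₚ.upTo⁺ _)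

  ballFacets-unique : ∀ n → Unique (ballFacets n)
  ballFacets-unique n = Uniqueₚ.concat⁺
    (Allₚ.map⁺ (All.tabulate λ {a} _ → Uniqueₚ.map⁺ (proj₂ ∘ ballFacet-injective) (between-unique (a + 2) (n ∸ 3))))
    (AllPairsₚ.map⁺ (AllPairs.map disjoint (between-unique 1 n)))
    where
    disjoint : ∀ {a a′} → a ≢ a′ →
      Disjoint (map (ballFacet a) (between (a + 2) (n ∸ 3))) (map (ballFacet a′) (between (a′ + 2) (n ∸ 3)))
    disjoint a≢a′ (F∈ , F∈′) with _ , _ , refl ← ∈-map⁻ _ F∈ with _ , _ , eq ← ∈-map⁻ _ F∈′ =
      a≢a′ (proj₁ (ballFacet-injective eq))

  ridge : ℕ → ℕ → ℕ → VSet
  ridge a b x = remove x (ballFacet a b)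

  ridge⊆ballFacet : ∀ a b x → ridge a b x ⊆ ballFacet a b
  ridge⊆ballFacet a b x = proj₁ ∘ ∈-remove⁻ x (ballFacet a b)

  count≡1 : ∀ {n a b} G → Admissible n a b → G ⊆ ballFacet a b →
    (∀ {a′ b′} → Admissible n a′ b′ → G ⊆ ballFacet a′ b′ → a′ ≡ a × b′ ≡ b) → count G (ballFacets n) ≡ 1
  count≡1 {n} G adm G⊆ only = unique-constant⇒length≡1
    (Uniqueₚ.filter⁺ (T? ∘ (G ⊆ᵇ_)) (ballFacets-unique n))
    (∈-filter⁺ (T? ∘ (G ⊆ᵇ_)) (∈-ballFacets⁺ adm) (⊆⇒⊆ᵇ G⊆))
    (λ F∈ → is-ballFacet (∈-filter⁻ (T? ∘ (G ⊆ᵇ_)) F∈))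
    where
    is-ballFacet : ∀ {F} → F ∈ ballFacets n × IsTrue (G ⊆ᵇ F) → F ≡ _
    is-ballFacet (F∈ , G⊆F) with a′ , b′ , adm′ , refl ← ∈-ballFacets⁻ {n} F∈ =
      let a′≡a , b′≡b = only adm′ (⊆ᵇ⇒⊆ G G⊆F) in cong₂ ballFacet a′≡a b′≡b

  2≤count : ∀ {n a b a′ b′} G → Admissible n a b → Admissible n a′ b′ → ballFacet a b ≢ ballFacet a′ b′ →
    G ⊆ ballFacet a b → G ⊆ ballFacet a′ b′ → 2 ≤ count G (ballFacets n)
  2≤count G adm adm′ distinct G⊆ G⊆′ = distinct⇒2≤length
    (∈-filter⁺ (T? ∘ (G ⊆ᵇ_)) (∈-ballFacets⁺ adm) (⊆⇒⊆ᵇ G⊆))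
    (∈-filter⁺ (T? ∘ (G ⊆ᵇ_)) (∈-ballFacets⁺ adm′) (⊆⇒⊆ᵇ G⊆′)) distinct

  data BoundaryRidge (n : ℕ) : VSet → Set where
    boundaryRidge : ∀ {a b x} → Admissible n a b → x ∈ ballFacet a b →
      count (ridge a b x) (ballFacets n) ≡ 1 → BoundaryRidge n (ridge a b x)

  ∈-D4⁻ : ∀ {n G} → G ∈ D4 n → BoundaryRidge n G
  ∈-D4⁻ {n} G∈
    with G∈′ , count≡ᵇ1 ← ∈-filter⁻ (T? ∘ λ S → count S (ballFacets n) ≡ᵇ 1)
                             {xs = concatMap ridges (ballFacets n)} G∈
    with F , F∈ , G∈ridges ← find (∈-concatMap⁻ ridges {xs = ballFacets n} G∈′)
    with a , b , adm , refl ← ∈-ballFacets⁻ {n} F∈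
    with x , x∈ , refl ← ∈-map⁻ (λ x → remove x (ballFacet a b)) G∈ridges =
    boundaryRidge adm x∈ (≡ᵇ⇒≡ _ 1 count≡ᵇ1)

  ∈-D4⁺ : ∀ {n G} → BoundaryRidge n G → G ∈ D4 n
  ∈-D4⁺ {n} (boundaryRidge {a} {b} {x} adm x∈ count≡1) =
    ∈-filter⁺ (T? ∘ λ S → count S (ballFacets n) ≡ᵇ 1)
      (∈-concatMap⁺ ridges (lose (∈-ballFacets⁺ adm) (∈-map⁺ (λ x → remove x (ballFacet a b)) x∈)))
      (≡⇒≡ᵇ _ 1 count≡1)

  ∈-ridge : ∀ {a b x y} → BallVertex a b y → y ≢ x → y ∈ ridge a b x
  ∈-ridge {x = x} vy = ∈-remove⁺ x (∈-ballFacet vy)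

  interiorRidge∈D4 : ∀ {n a b x} → Admissible n a b → BallVertex a b x → b < x → x < 3 + b → ridge a b x ∈ D4 n
  interiorRidge∈D4 {n} {a} {b} {x} adm@(_ , 2+a≤b , _) vx b<x x<3+b =
    ∈-D4⁺ (boundaryRidge adm (∈-ballFacet vx) (count≡1 (ridge a b x) adm (ridge⊆ballFacet a b x) only))
    where
    1+a<x : 1 + a < x
    1+a<x = ≤-trans 2+a≤b (<⇒≤ b<x)
    only : ∀ {a′ b′} → Admissible n a′ b′ → ridge a b x ⊆ ballFacet a′ b′ → a′ ≡ a × b′ ≡ b
    only (_ , 2+a′≤b′ , _) ridge⊆ =
      let a≡a′ , b≡b′ = ballFacet-determined (proj₁ (proj₂ adm)) 2+a′≤b′
            (vertex a₀ (<⇒≢ (<-trans (n<1+n a) 1+a<x))) (vertex a₁ (<⇒≢ 1+a<x))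
            (vertex b₀ (<⇒≢ b<x)) (vertex b₃ (>⇒≢ x<3+b))
      in sym a≡a′ , sym b≡b′
      where
      vertex : ∀ {y} → BallVertex a b y → y ≢ x → BallVertex _ _ y
      vertex vy y≢x = ballVertex (ridge⊆ (∈-ridge vy y≢x))

  ridge-b₁∈D4 : ∀ {n a b} → Admissible n a b → ridge a b (1 + b) ∈ D4 n
  ridge-b₁∈D4 {b = b} adm = interiorRidge∈D4 adm b₁ (n<1+n b) (≤-trans (n<1+n (1 + b)) (n≤1+n _))

  ridge-b₂∈D4 : ∀ {n a b} → Admissible n a b → ridge a b (2 + b) ∈ D4 n
  ridge-b₂∈D4 {b = b} adm = interiorRidge∈D4 adm b₂ (≤-trans (n<1+n b) (n≤1+n _)) (n<1+n (2 + b))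

  -- The first flip at i = t + 1 is the translate by t of a configuration at i = 1, so the finite set
  -- computations it requires are carried out by evaluation at t = 0.
  shift : ℕ → VSet → VSet
  shift t = map (_+ t)

  ≡ᵇ-shift : ∀ c d t → (c + t ≡ᵇ d + t) ≡ (c ≡ᵇ d)
  ≡ᵇ-shift c d zero = cong₂ _≡ᵇ_ (+-identityʳ c) (+-identityʳ d)
  ≡ᵇ-shift c d (suc t) rewrite +-suc c t | +-suc d t = ≡ᵇ-shift c d t

  ∈ᵇ-shift : ∀ c ds t → ((c + t) ∈ᵇ shift t ds) ≡ (c ∈ᵇ ds)
  ∈ᵇ-shift c [] t = refl
  ∈ᵇ-shift c (d ∷ ds) t = cong₂ _∨_ (≡ᵇ-shift c d t) (∈ᵇ-shift c ds t)

  ⊆ᵇ-shift : ∀ cs ds t → (shift t cs ⊆ᵇ shift t ds) ≡ (cs ⊆ᵇ ds)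
  ⊆ᵇ-shift [] ds t = refl
  ⊆ᵇ-shift (c ∷ cs) ds t = cong₂ _∧_ (∈ᵇ-shift c ds t) (⊆ᵇ-shift cs ds t)

  ≈ᵇ-shift : ∀ cs ds t → (shift t cs ≈ᵇ shift t ds) ≡ (cs ≈ᵇ ds)
  ≈ᵇ-shift cs ds t = cong₂ _∧_ (⊆ᵇ-shift cs ds t) (⊆ᵇ-shift ds cs t)

  ∈ˢ-shift : ∀ cs Ds t → (shift t cs ∈ˢ map (shift t) Ds) ≡ (cs ∈ˢ Ds)
  ∈ˢ-shift cs [] t = refl
  ∈ˢ-shift cs (D ∷ Ds) t = cong₂ _∨_ (≈ᵇ-shift cs D t) (∈ˢ-shift cs Ds t)

  remove-shift : ∀ c ds t → remove (c + t) (shift t ds) ≡ shift t (remove c ds)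
  remove-shift c [] t = refl
  remove-shift c (d ∷ ds) t rewrite ≡ᵇ-shift d c t with d ≡ᵇ c
  ... | true = remove-shift c ds t
  ... | false = cong (d + t ∷_) (remove-shift c ds t)

  joinBdry-shift : ∀ as bs t → joinBdry (shift t as) (shift t bs) ≡ map (shift t) (joinBdry as bs)
  joinBdry-shift as bs t = begin
    map (λ y → shift t as ++ remove y (shift t bs)) (shift t bs)  ≡⟨ map-∘ bs ⟨
    map (λ c → shift t as ++ remove (c + t) (shift t bs)) bs      ≡⟨ map-cong shift-face bs ⟩
    map (shift t ∘ λ c → as ++ remove c bs) bs                    ≡⟨ map-∘ bs ⟩
    map (shift t) (joinBdry as bs)                                ∎
    where
    open ≡-Reasoning
    shift-face : ∀ c → shift t as ++ remove (c + t) (shift t bs) ≡ shift t (as ++ remove c bs)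
    shift-face c = trans (cong (shift t as ++_) (remove-shift c bs t)) (sym (map-++ (_+ t) as (remove c bs)))

  ballFacet-shift : ∀ c₁ c₂ t → ballFacet (c₁ + t) (c₂ + t) ≡ shift t (ballFacet c₁ c₂)
  ballFacet-shift c₁ c₂ t = cong (λ z → c₁ + t ∷ suc (c₁ + t) ∷ c₂ + t ∷ suc (c₂ + t) ∷ z)
    (cong₂ (λ x y → x ∷ y ∷ []) (+-comm-shift 2) (+-comm-shift 3))
    where
    +-comm-shift : ∀ k → c₂ + t + k ≡ c₂ + k + t
    +-comm-shift k = trans (+-assoc c₂ t k) (trans (cong (c₂ +_) (+-comm t k)) (sym (+-assoc c₂ k t)))

  ridge-shift : ∀ c₁ c₂ cₓ t → ridge (c₁ + t) (c₂ + t) (cₓ + t) ≡ shift t (ridge c₁ c₂ cₓ)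
  ridge-shift c₁ c₂ cₓ t = trans (cong (remove (cₓ + t)) (ballFacet-shift c₁ c₂ t)) (remove-shift cₓ (ballFacet c₁ c₂) t)

  Aset-shift : ∀ t → Aset 0 (suc t) ≡ shift t (Aset 0 1)
  Aset-shift t = cong (suc t ∷_) (cong₂ (λ x y → x ∷ y ∷ []) (+-comm (suc t) 2) (+-comm (suc t) 4))

  Bset-shift : ∀ t → Bset 0 (suc t) ≡ shift t (Bset 0 1)
  Bset-shift t = cong (t ∷_) (cong₂ (λ x y → x ∷ y ∷ []) (+-comm (suc t) 1) (+-comm (suc t) 5))

  offset-≰ : ∀ c d {x} → {IsTrue (d <ᵇ c)} → ¬ c + x ≤ d + x
  offset-≰ c d {x} {d<ᵇc} = <⇒≱ (+-monoˡ-< x (<ᵇ⇒< d c d<ᵇc))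

  data ThroughAset (t : ℕ) : ℕ → ℕ → Set where
    facet₁₃ : ThroughAset t (1 + t) (3 + t)
    facet₀₃ : ThroughAset t t (3 + t)
    facet₀₂ : ThroughAset t t (2 + t)

  throughAset : ∀ {t a b} → 2 + a ≤ b →
    BallVertex a b (1 + t) → BallVertex a b (3 + t) → BallVertex a b (5 + t) → ThroughAset t a b
  throughAset _ a₀ b₀ b₂ = facet₁₃
  throughAset _ a₁ b₀ b₂ = facet₀₃
  throughAset _ a₁ b₁ b₃ = facet₀₂
  throughAset h a₀ b₁ b₃ = ⊥-elim (offset-≰ 3 2 h)
  throughAset h b₀ b₂ a₀ = ⊥-elim (offset-≰ 7 1 h)
  throughAset h b₀ b₂ a₁ = ⊥-elim (offset-≰ 6 1 h)
  throughAset h b₁ b₃ a₀ = ⊥-elim (offset-≰ 7 0 h)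
  throughAset h b₁ b₃ a₁ = ⊥-elim (offset-≰ 6 0 h)
  throughAset _ a₀ b₂ ()
  throughAset _ a₀ b₃ ()
  throughAset _ a₁ b₂ ()
  throughAset _ a₁ b₃ ()
  throughAset _ b₀ a₀ ()
  throughAset _ b₀ a₁ ()
  throughAset _ b₁ a₀ ()
  throughAset _ b₁ a₁ ()
  throughAset _ b₂ a₀ ()
  throughAset _ b₂ a₁ ()
  throughAset _ b₃ a₀ ()
  throughAset _ b₃ a₁ ()

  no-ballFacet-through-Bset : ∀ {a b t} → 2 + a ≤ b → BallVertex a b t → BallVertex a b (2 + t) → BallVertex a b (6 + t) → ⊥
  no-ballFacet-through-Bset {a} {b} {t} 2+a≤b vt vt₂ vt₆ =
    1+n≰n (≤-trans 2+a≤b-via-t (ballVertex-<b 2+a≤b vt₂ 2+t<b))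
    where
    2+t<b : 2 + t < b
    2+t<b = +-cancelˡ-≤ 3 (3 + t) b (ballVertex-≤ 2+a≤b vt₆)
    2+a≤b-via-t : 2 + a ≤ 2 + t
    2+a≤b-via-t = +-monoʳ-≤ 2 (ballVertex-≥ 2+a≤b vt)

  module FirstFlip {n t : ℕ} (1≤t : 1 ≤ t) (6+t≤n : 6 + t ≤ n) where

    A B : VSet
    A = Aset 0 (suc t)
    B = Bset 0 (suc t)

    joinBdry-shifted : joinBdry A B ≡ map (shift t) (joinBdry (Aset 0 1) (Bset 0 1))
    joinBdry-shifted = trans (cong₂ joinBdry (Aset-shift t) (Bset-shift t)) (joinBdry-shift (Aset 0 1) (Bset 0 1) t)

    1+t∈A : 1 + t ∈ A
    1+t∈A = here refl

    3+t∈A : 3 + t ∈ A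
    3+t∈A = subst (_∈ A) (+-comm (suc t) 2) (there (here refl))

    5+t∈A : 5 + t ∈ A
    5+t∈A = subst (_∈ A) (+-comm (suc t) 4) (there (there (here refl)))

    t∈B : t ∈ B
    t∈B = here refl

    2+t∈B : 2 + t ∈ B
    2+t∈B = subst (_∈ B) (+-comm (suc t) 1) (there (here refl))

    6+t∈B : 6 + t ∈ B
    6+t∈B = subst (_∈ B) (+-comm (suc t) 5) (there (there (here refl)))

    shifted-⊆ᵇ : ∀ {X Y} cs ds → X ≡ shift t cs → Y ≡ shift t ds → IsTrue (cs ⊆ᵇ ds) → IsTrue (X ⊆ᵇ Y)
    shifted-⊆ᵇ cs ds refl refl = subst IsTrue (sym (⊆ᵇ-shift cs ds t))

    shifted-≈ᵇ : ∀ {X Y} cs ds → X ≡ shift t cs → Y ≡ shift t ds → IsTrue (cs ≈ᵇ ds) → IsTrue (X ≈ᵇ Y)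
    shifted-≈ᵇ cs ds refl refl = subst IsTrue (sym (≈ᵇ-shift cs ds t))

    admissible : ∀ c₁ c₂ → {IsTrue (2 + c₁ ≤ᵇ c₂)} → {IsTrue (c₂ ≤ᵇ 3)} → Admissible n (c₁ + t) (c₂ + t)
    admissible c₁ c₂ {2+c₁≤c₂} {c₂≤3} =
      ≤-trans 1≤t (m≤n+m t c₁) , +-monoˡ-≤ t (≤ᵇ⇒≤ _ _ 2+c₁≤c₂) ,
      ≤-trans (+-monoˡ-≤ t (+-monoʳ-≤ 3 (≤ᵇ⇒≤ _ _ c₂≤3))) 6+t≤n

    ridge∈joinBdry : ∀ c₁ c₂ cₓ → {IsTrue (ridge c₁ c₂ cₓ ∈ˢ joinBdry (Aset 0 1) (Bset 0 1))} →
      IsTrue (ridge (c₁ + t) (c₂ + t) (cₓ + t) ∈ˢ joinBdry A B)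
    ridge∈joinBdry c₁ c₂ cₓ {h} = subst IsTrue (sym (trans (cong₂ _∈ˢ_ (ridge-shift c₁ c₂ cₓ t) joinBdry-shifted)
      (∈ˢ-shift (ridge c₁ c₂ cₓ) (joinBdry (Aset 0 1) (Bset 0 1)) t))) h

    shared-ridge : ∀ c₁ c₂ cₓ d₁ d₂ → ballFacet c₁ c₂ ≢ ballFacet d₁ d₂ →
      {IsTrue (2 + c₁ ≤ᵇ c₂)} → {IsTrue (c₂ ≤ᵇ 3)} → {IsTrue (2 + d₁ ≤ᵇ d₂)} → {IsTrue (d₂ ≤ᵇ 3)} →
      {IsTrue (ridge c₁ c₂ cₓ ⊆ᵇ ballFacet d₁ d₂)} →
      count (ridge (c₁ + t) (c₂ + t) (cₓ + t)) (ballFacets n) ≢ 1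
    shared-ridge c₁ c₂ cₓ d₁ d₂ distinct {p} {q} {p′} {q′} {⊆d} count≡1 =
      1+n≰n (subst (2 ≤_) count≡1 (2≤count _ (admissible c₁ c₂ {p} {q}) (admissible d₁ d₂ {p′} {q′}) ≢shifted
        (ridge⊆ballFacet _ _ _) ⊆shifted))
      where
      ≢shifted : ballFacet (c₁ + t) (c₂ + t) ≢ ballFacet (d₁ + t) (d₂ + t)
      ≢shifted eq = let e₁ , e₂ = ballFacet-injective eq in
        distinct (cong₂ ballFacet (+-cancelʳ-≡ t c₁ d₁ e₁) (+-cancelʳ-≡ t c₂ d₂ e₂))
      ⊆shifted : ridge (c₁ + t) (c₂ + t) (cₓ + t) ⊆ ballFacet (d₁ + t) (d₂ + t)
      ⊆shifted = ⊆ᵇ⇒⊆ _ (shifted-⊆ᵇ (ridge c₁ c₂ cₓ) (ballFacet d₁ d₂)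
        (ridge-shift c₁ c₂ cₓ t) (ballFacet-shift d₁ d₂ t) ⊆d)

    -- In each ball facet through A the ridge missing 4 + t lies in ∂A * B; the other two ridges containing A
    -- lie in a second ball facet and are therefore not boundary ridges.
    star-ridge : ∀ {a b x} → ThroughAset t a b → BallVertex a b x → 1 + t ≢ x → 3 + t ≢ x → 5 + t ≢ x →
      count (ridge a b x) (ballFacets n) ≡ 1 → IsTrue (ridge a b x ∈ˢ joinBdry A B)
    star-ridge facet₁₃ a₀ ≢x _ _ _ = contradiction refl ≢x
    star-ridge facet₁₃ a₁ _ _ _ c = contradiction c (shared-ridge 1 3 2 0 3 λ ())
    star-ridge facet₁₃ b₀ _ ≢x _ _ = contradiction refl ≢x
    star-ridge facet₁₃ b₁ _ _ _ _ = ridge∈joinBdry 1 3 4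
    star-ridge facet₁₃ b₂ _ _ ≢x _ = contradiction refl ≢x
    star-ridge facet₁₃ b₃ _ _ _ c = contradiction c (shared-ridge 1 3 6 0 2 λ ())
    star-ridge facet₀₃ a₀ _ _ _ c = contradiction c (shared-ridge 0 3 0 1 3 λ ())
    star-ridge facet₀₃ a₁ ≢x _ _ _ = contradiction refl ≢x
    star-ridge facet₀₃ b₀ _ ≢x _ _ = contradiction refl ≢x
    star-ridge facet₀₃ b₁ _ _ _ _ = ridge∈joinBdry 0 3 4
    star-ridge facet₀₃ b₂ _ _ ≢x _ = contradiction refl ≢x
    star-ridge facet₀₃ b₃ _ _ _ c = contradiction c (shared-ridge 0 3 6 0 2 λ ())
    star-ridge facet₀₂ a₀ _ _ _ c = contradiction c (shared-ridge 0 2 0 1 3 λ ())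
    star-ridge facet₀₂ a₁ ≢x _ _ _ = contradiction refl ≢x
    star-ridge facet₀₂ b₀ _ _ _ c = contradiction c (shared-ridge 0 2 2 0 3 λ ())
    star-ridge facet₀₂ b₁ _ ≢x _ _ = contradiction refl ≢x
    star-ridge facet₀₂ b₂ _ _ _ _ = ridge∈joinBdry 0 2 4
    star-ridge facet₀₂ b₃ _ _ ≢x _ = contradiction refl ≢x

    Bset-not-face : IsTrue (not (isFace B (D4 n)))
    Bset-not-face = T-not⁺ λ h → let F , F∈ , B⊆F = isFace⇒⊆ B (D4 n) h in through-B (∈-D4⁻ {n} F∈) B⊆F
      where
      through-B : ∀ {F} → BoundaryRidge n F → B ⊆ F → ⊥
      through-B (boundaryRidge {a} {b} {x} (_ , 2+a≤b , _) _ _) B⊆F =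
        no-ballFacet-through-Bset 2+a≤b (vertex t∈B) (vertex 2+t∈B) (vertex 6+t∈B)
        where
        vertex : ∀ {y} → y ∈ B → BallVertex a b y
        vertex = ballVertex ∘ ridge⊆ballFacet a b x ∘ B⊆F

    Aset-face : IsTrue (isFace A (D4 n))
    Aset-face = any⁺ (A ⊆ᵇ_) (lose (ridge-b₁∈D4 (admissible 1 3))
      (shifted-⊆ᵇ (Aset 0 1) (ridge 1 3 4) (Aset-shift t) (ridge-shift 1 3 4 t) _))

    star⊆joinBdry : ∀ {G} → G ∈ D4 n → A ⊆ G → IsTrue (G ∈ˢ joinBdry A B)
    star⊆joinBdry G∈ A⊆G with ∈-D4⁻ {n} G∈
    ... | boundaryRidge {a} {b} {x} (_ , 2+a≤b , _) x∈ count≡1 =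
      star-ridge (throughAset 2+a≤b (vertex 1+t∈A) (vertex 3+t∈A) (vertex 5+t∈A)) (ballVertex x∈)
        (≢x 1+t∈A) (≢x 3+t∈A) (≢x 5+t∈A) count≡1
      where
      vertex : ∀ {y} → y ∈ A → BallVertex a b y
      vertex = ballVertex ∘ ridge⊆ballFacet a b x ∘ A⊆G
      ≢x : ∀ {y} → y ∈ A → y ≢ x
      ≢x = proj₂ ∘ ∈-remove⁻ x (ballFacet a b) ∘ A⊆G

    joinBdry⊆star : ∀ {J} → J ∈ joinBdry A B → IsTrue (J ∈ˢ starFacets A (D4 n))
    joinBdry⊆star {J} J∈ with J₀ , J₀∈ , refl ← ∈-map⁻ (shift t) (subst (J ∈_) joinBdry-shifted J∈) = in-star J₀∈
      where
      witness : ∀ {J₀ G} G₀ → G ∈ D4 n → G ≡ shift t G₀ → IsTrue (Aset 0 1 ⊆ᵇ G₀) → IsTrue (J₀ ≈ᵇ G₀) →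
        IsTrue (shift t J₀ ∈ˢ starFacets A (D4 n))
      witness {J₀} G₀ G∈ G≡ A⊆ J≈ =
        any⁺ _ (lose (∈-filter⁺ (T? ∘ (A ⊆ᵇ_)) G∈ (shifted-⊆ᵇ (Aset 0 1) G₀ (Aset-shift t) G≡ A⊆))
        (shifted-≈ᵇ J₀ G₀ refl G≡ J≈))
      in-star : ∀ {J₀} → J₀ ∈ joinBdry (Aset 0 1) (Bset 0 1) → IsTrue (shift t J₀ ∈ˢ starFacets A (D4 n))
      in-star {J₀} (here refl) = witness {J₀} (ridge 1 3 4) (ridge-b₁∈D4 (admissible 1 3)) (ridge-shift 1 3 4 t) _ _
      in-star {J₀} (there (here refl)) = witness {J₀} (ridge 0 3 4) (ridge-b₁∈D4 (admissible 0 3)) (ridge-shift 0 3 4 t) _ _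
      in-star {J₀} (there (there (here refl))) = witness {J₀} (ridge 0 2 4) (ridge-b₂∈D4 (admissible 0 2)) (ridge-shift 0 2 4 t) _ _

    flipCond-holds : IsTrue (flipCond 0 (D4 n) (suc t))
    flipCond-holds = ∧-intro Bset-not-face (∧-intro Aset-face (∧-intro
      (all⁻ _ (All.tabulate λ G∈ → let G∈D4 , A⊆G = ∈-filter⁻ (T? ∘ (A ⊆ᵇ_)) {xs = D4 n} G∈ in
        star⊆joinBdry G∈D4 (⊆ᵇ⇒⊆ A A⊆G)))
      (all⁻ _ (All.tabulate joinBdry⊆star))))
      where
      ∧-intro : ∀ {p q} → IsTrue p → IsTrue q → IsTrue (p ∧ q)
      ∧-intro p q = Equivalence.from T-∧ (p , q)

  flipCond-first : ∀ n → IsTrue (all (flipCond 0 (D4 n)) (indices n 0))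
  flipCond-first n = all⁻ _ (All.tabulate λ {i} i∈ → holds i (∈-between⁻ 2 (n ∸ 5) i∈))
    where
    holds : ∀ i → 2 ≤ i × i ≤ n ∸ 5 → IsTrue (flipCond 0 (D4 n) i)
    holds (suc t) (s≤s 1≤t , 1+t≤n∸5) = FirstFlip.flipCond-holds 1≤t 6+t≤n
      where
      6+t≤n : 6 + t ≤ n
      6+t≤n = subst (_≤ n) (+-comm (suc t) 5) (m≤o∸n⇒m+n≤o (suc t) 5≤n 1+t≤n∸5)
        where
        5≤n : 5 ≤ n
        5≤n = <⇒≤ (0<∸⇒< (≤-trans (s≤s z≤n) 1+t≤n∸5))

  removed added : ℕ → ℕ → Complex
  removed n k = concatMap (λ i → joinBdry (Aset k i) (Bset k i)) (indices n k)
  added n k = concatMap (λ i → joinBdry (Bset k i) (Aset k i)) (indices n k)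

  flipStep-keeps : ∀ n k Δ {G} → G ∈ Δ → ¬ IsTrue (G ∈ˢ removed n k) → G ∈ flipStep n k Δ
  flipStep-keeps n k Δ G∈ not-removed with all (flipCond k Δ) (indices n k)
  ... | true = ∈-++⁺ˡ (∈-filter⁺ (T? ∘ λ F → not (F ∈ˢ removed n k)) G∈ (T-not⁺ not-removed))
  ... | false = G∈

  flipStep-adds : ∀ n k Δ {G} → IsTrue (all (flipCond k Δ) (indices n k)) → G ∈ added n k → G ∈ flipStep n k Δ
  flipStep-adds n k Δ conditions G∈ with all (flipCond k Δ) (indices n k)
  ... | true = ∈-++⁺ʳ (filterᵇ (λ F → not (F ∈ˢ removed n k)) Δ) G∈
  ... | false = ⊥-elim conditions

  flipStep⁻ : ∀ n k Δ {G} → G ∈ flipStep n k Δ → G ∈ Δ ⊎ G ∈ added n k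
  flipStep⁻ n k Δ G∈ with all (flipCond k Δ) (indices n k)
  ... | false = inj₁ G∈
  ... | true with ∈-++⁻ (filterᵇ (λ F → not (F ∈ˢ removed n k)) Δ) G∈
  ...   | inj₁ kept = inj₁ (proj₁ (∈-filter⁻ (T? ∘ λ F → not (F ∈ˢ removed n k)) kept))
  ...   | inj₂ new = inj₂ new

  ∈-flipFaces⁻ : ∀ n k (X Y : ℕ → VSet) {G} → G ∈ concatMap (λ i → joinBdry (X i) (Y i)) (indices n k) →
    ∃[ i ] ∃[ β ] i ∈ indices n k × G ≡ X i ++ remove β (Y i)
  ∈-flipFaces⁻ n k X Y G∈
    with i , i∈ , G∈′ ← find (∈-concatMap⁻ (λ i → joinBdry (X i) (Y i)) {xs = indices n k} G∈)
    with β , _ , refl ← ∈-map⁻ (λ β → X i ++ remove β (Y i)) G∈′ = i , β , i∈ , refl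

  flipSets-window : ∀ k i {y} → y ∈ Aset k i ⊎ y ∈ Bset k i → i ∸ (k + 1) ≤ y × y ≤ i + 5
  flipSets-window k i (inj₁ (here refl)) = ∸-monoʳ-≤ i (m≤m+n k 1) , ≤-trans (m∸n≤m i k) (m≤m+n i 5)
  flipSets-window k i (inj₁ (there (here refl))) = ≤-trans (m∸n≤m i (k + 1)) (m≤m+n i 2) , +-monoʳ-≤ i (≤ᵇ⇒≤ 2 5 _)
  flipSets-window k i (inj₁ (there (there (here refl)))) = ≤-trans (m∸n≤m i (k + 1)) (m≤m+n i 4) , +-monoʳ-≤ i (≤ᵇ⇒≤ 4 5 _)
  flipSets-window k i (inj₂ (here refl)) = ≤-refl , ≤-trans (m∸n≤m i (k + 1)) (m≤m+n i 5)
  flipSets-window k i (inj₂ (there (here refl))) = ≤-trans (m∸n≤m i (k + 1)) (m≤m+n i 1) , +-monoʳ-≤ i (≤ᵇ⇒≤ 1 5 _)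
  flipSets-window k i (inj₂ (there (there (here refl)))) = ≤-trans (m∸n≤m i (k + 1)) (m≤m+n i 5) , ≤-refl

  flipFace-window : ∀ k i X Y β → (∀ {y} → y ∈ X ⊎ y ∈ Y → i ∸ (k + 1) ≤ y × y ≤ i + 5) →
    ∀ {y} → y ∈ X ++ remove β Y → i ∸ (k + 1) ≤ y × y ≤ i + 5
  flipFace-window k i X Y β window y∈ with ∈-++⁻ X y∈
  ... | inj₁ y∈X = window (inj₁ y∈X)
  ... | inj₂ y∈Y = window (inj₂ (proj₁ (∈-remove⁻ β Y y∈Y)))

  window-width : ∀ k i {y z} → k + 1 ≤ i → i ∸ (k + 1) ≤ y → z ≤ i + 5 → z ≤ 6 + k + y
  window-width k i {y} {z} k+1≤i i∸k+1≤y z≤i+5 = begin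
    z                   ≤⟨ z≤i+5 ⟩
    i + 5               ≤⟨ +-monoˡ-≤ 5 (≤-trans (m≤n+m∸n i (k + 1)) (+-monoʳ-≤ (k + 1) i∸k+1≤y)) ⟩
    (k + 1 + y) + 5     ≡⟨ solve 2 (λ k y → (k :+ con 1 :+ y) :+ con 5 := con 6 :+ k :+ y) refl k y ⟩
    6 + k + y           ∎
    where
    open ≤-Reasoning
    open +-*-Solver

  wide-not-removed : ∀ {n k G y z} → y ∈ G → z ∈ G → 6 + k + y < z → ¬ IsTrue (G ∈ˢ removed n k)
  wide-not-removed {n} {k} {G} y∈ z∈ wide G∈ˢ
    with F , F∈ , G⊆F , _ ← ∈ˢ⇒⊆ G (removed n k) G∈ˢ
    with i , β , i∈ , refl ← ∈-flipFaces⁻ n k (Aset k) (Bset k) F∈ =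
    <⇒≱ wide (window-width k i (≤-trans (+-monoʳ-≤ k (s≤s z≤n)) (proj₁ (∈-between⁻ (k + 2) (n ∸ 5) i∈)))
      (proj₁ (window (G⊆F y∈))) (proj₂ (window (G⊆F z∈))))
    where
    window = flipFace-window k i (Aset k i) (Bset k i) β (flipSets-window k i)

  wide∈Γ : ∀ k {n G y z} → G ∈ D4 n → y ∈ G → z ∈ G → 5 + k + y < z → G ∈ Γ n k
  wide∈Γ zero G∈ _ _ _ = G∈
  wide∈Γ (suc k) {n} G∈ y∈ z∈ wide =
    flipStep-keeps n k (Γ n k) (wide∈Γ k G∈ y∈ z∈ (≤-trans (n≤1+n _) wide)) (wide-not-removed {n} {k} y∈ z∈ wide)

  interiorRidge∈Γ : ∀ k {n a b x} → Admissible n a b → BallVertex a b x → b < x → x < 3 + b → 3 + k + a ≤ b →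
    ridge a b x ∈ Γ n k
  interiorRidge∈Γ k {a = a} {b} adm@(_ , 2+a≤b , _) vx b<x x<3+b far =
    wide∈Γ k (interiorRidge∈D4 adm vx b<x x<3+b) (∈-ridge {a} {b} a₀ (<⇒≢ a<x)) (∈-ridge {a} {b} b₃ (>⇒≢ x<3+b))
      (s≤s (s≤s (s≤s far)))
    where
    a<x = <-trans (≤-trans (n<1+n _) (≤-trans (n≤1+n _) 2+a≤b)) b<x

  flippedFacet : ℕ → VSet
  flippedFacet t = Bset 0 (suc t) ++ remove (suc t + 2) (Aset 0 (suc t))

  data FlippedVertex (t : ℕ) : ℕ → Set where
    f₀ : FlippedVertex t t
    f₁ : FlippedVertex t (1 + t)
    f₂ : FlippedVertex t (2 + t)
    f₅ : FlippedVertex t (5 + t)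
    f₆ : FlippedVertex t (6 + t)

  flippedVertex : ∀ t {y} → y ∈ flippedFacet t → FlippedVertex t y
  flippedVertex t y∈ with ∈-++⁻ (Bset 0 (suc t)) y∈
  ... | inj₁ (here refl) = f₀
  ... | inj₁ (there (here refl)) = subst (FlippedVertex t) (+-comm 1 (suc t)) f₂
  ... | inj₁ (there (there (here refl))) = subst (FlippedVertex t) (+-comm 5 (suc t)) f₆
  ... | inj₂ y∈A with ∈-remove⁻ (suc t + 2) (Aset 0 (suc t)) y∈A
  ...   | here refl , _ = f₁
  ...   | there (here refl) , y≢ = contradiction refl y≢
  ...   | there (there (here refl)) , _ = subst (FlippedVertex t) (+-comm 4 (suc t)) f₅

  flippedVertex-≥ : ∀ {t y} → FlippedVertex t y → t ≤ y
  flippedVertex-≥ f₀ = ≤-refl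
  flippedVertex-≥ {t} f₁ = m≤n+m t 1
  flippedVertex-≥ {t} f₂ = m≤n+m t 2
  flippedVertex-≥ {t} f₅ = m≤n+m t 5
  flippedVertex-≥ {t} f₆ = m≤n+m t 6

  no-flippedVertex-gap : ∀ {t i} → t ≤ i → FlippedVertex t (2 + i) → FlippedVertex t (4 + i) → ⊥
  no-flippedVertex-gap {i = i} t≤i f₀ f₂ = 1+n≰n (≤-trans t≤i (n≤1+n i))
  no-flippedVertex-gap _ f₁ ()
  no-flippedVertex-gap _ f₂ ()
  no-flippedVertex-gap _ f₅ ()
  no-flippedVertex-gap _ f₆ ()

  flippedFacet-not-removed : ∀ n k t → ¬ IsTrue (flippedFacet t ∈ˢ removed n k)
  flippedFacet-not-removed n k t F∈ˢ
    with F , F∈ , _ , F⊆ ← ∈ˢ⇒⊆ (flippedFacet t) (removed n k) F∈ˢ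
    with i , β , _ , refl ← ∈-flipFaces⁻ n k (Aset k) (Bset k) F∈ =
    no-flippedVertex-gap (≤-trans (flippedVertex-≥ (vertex (here refl))) (m∸n≤m i k))
      (subst (FlippedVertex t) (+-comm i 2) (vertex (there (here refl))))
      (subst (FlippedVertex t) (+-comm i 4) (vertex (there (there (here refl)))))
    where
    vertex : ∀ {y} → y ∈ Aset k i → FlippedVertex t y
    vertex = flippedVertex t ∘ F⊆ ∘ ∈-++⁺ˡ

  flippedFacet∈Γ : ∀ k {n t} → 1 ≤ t → 6 + t ≤ n → flippedFacet t ∈ Γ n (suc k)
  flippedFacet∈Γ zero {n} {t} 1≤t 6+t≤n = flipStep-adds n 0 (D4 n) (flipCond-first n)
    (∈-concatMap⁺ (λ i → joinBdry (Bset 0 i) (Aset 0 i))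
      (lose i∈ (∈-map⁺ (λ α → Bset 0 (suc t) ++ remove α (Aset 0 (suc t))) α∈)))
    where
    α∈ : suc t + 2 ∈ Aset 0 (suc t)
    α∈ = there (here refl)
    i∈ : suc t ∈ indices n 0
    i∈ = ∈-between⁺ 2 (n ∸ 5) (s≤s 1≤t) (m+n≤o⇒m≤o∸n (suc t) (subst (_≤ n) (+-comm 5 (suc t)) 6+t≤n))
  flippedFacet∈Γ (suc k) {n} {t} 1≤t 6+t≤n =
    flipStep-keeps n (suc k) (Γ n (suc k)) (flippedFacet∈Γ k 1≤t 6+t≤n) (flippedFacet-not-removed n (suc k) t)

  VerticesIn : ℕ → Complex → Set
  VerticesIn n Δ = ∀ {G y} → G ∈ Δ → y ∈ G → 1 ≤ y × y ≤ n

  D4-vertices : ∀ n → VerticesIn n (D4 n)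
  D4-vertices n G∈ y∈ with ∈-D4⁻ {n} G∈
  ... | boundaryRidge {a} {b} {x} (1≤a , 2+a≤b , 3+b≤n) _ _ =
    ≤-trans 1≤a (ballVertex-≥ 2+a≤b vy) , ≤-trans (ballVertex-≤ 2+a≤b vy) 3+b≤n
    where
    vy = ballVertex (ridge⊆ballFacet a b x y∈)

  flipStep-vertices : ∀ n k Δ → VerticesIn n Δ → VerticesIn n (flipStep n k Δ)
  flipStep-vertices n k Δ inΔ G∈ y∈ with flipStep⁻ n k Δ G∈
  ... | inj₁ G∈Δ = inΔ G∈Δ y∈
  ... | inj₂ G∈added with i , α , i∈ , refl ← ∈-flipFaces⁻ n k (Bset k) (Aset k) G∈added =
    ≤-trans 1≤i∸[k+1] (proj₁ window) , ≤-trans (proj₂ window) i+5≤n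
    where
    window = flipFace-window k i (Bset k i) (Aset k i) α (flipSets-window k i ∘ swap) y∈
    k+2≤i = proj₁ (∈-between⁻ (k + 2) (n ∸ 5) i∈)
    i≤n∸5 = proj₂ (∈-between⁻ (k + 2) (n ∸ 5) i∈)
    1≤i∸[k+1] : 1 ≤ i ∸ (k + 1)
    1≤i∸[k+1] = m+n≤o⇒m≤o∸n 1 (subst (_≤ i) (+-suc k 1) k+2≤i)
    i+5≤n : i + 5 ≤ n
    i+5≤n = m≤o∸n⇒m+n≤o i (<⇒≤ (0<∸⇒< (≤-trans (≤-trans (s≤s z≤n) (≤-trans (m≤n+m 2 k) k+2≤i)) i≤n∸5)))
      i≤n∸5

  Γ-vertices : ∀ n k → VerticesIn n (Γ n k)
  Γ-vertices n zero = D4-vertices n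
  Γ-vertices n (suc k) = flipStep-vertices n k (Γ n k) (Γ-vertices n k)

  countIn : (ℕ → Bool) → ℕ → ℕ → ℕ
  countIn f p zero = 0
  countIn f p (suc m) = if f p then suc (countIn f (suc p) m) else countIn f (suc p) m

  countIn-≤ : ∀ f p m → countIn f p m ≤ m
  countIn-≤ f p zero = z≤n
  countIn-≤ f p (suc m) with f p
  ... | true = s≤s (countIn-≤ f (suc p) m)
  ... | false = m≤n⇒m≤1+n (countIn-≤ f (suc p) m)

  countIn-+ : ∀ f p k m → countIn f p (k + m) ≡ countIn f p k + countIn f (k + p) m
  countIn-+ f p zero m = refl
  countIn-+ f p (suc k) m rewrite countIn-+ f (suc p) k m | +-suc k p with f p
  ... | true = refl
  ... | false = refl

  countIn-partition : ∀ f p m → countIn f p m + countIn (not ∘ f) p m ≡ m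
  countIn-partition f p zero = refl
  countIn-partition f p (suc m) with f p
  ... | true = cong suc (countIn-partition f (suc p) m)
  ... | false = trans (+-suc _ _) (cong suc (countIn-partition f (suc p) m))

  countIn-mono : ∀ {f g} → (∀ x → f x ≡ true → g x ≡ true) → ∀ p m → countIn f p m ≤ countIn g p m
  countIn-mono f⇒g p zero = z≤n
  countIn-mono {f} {g} f⇒g p (suc m) with f p in fp | g p in gp
  ... | true | true = s≤s (countIn-mono f⇒g (suc p) m)
  ... | true | false = contradiction (trans (sym (f⇒g p fp)) gp) λ ()
  ... | false | true = m≤n⇒m≤1+n (countIn-mono f⇒g (suc p) m)
  ... | false | false = countIn-mono f⇒g (suc p) m

  countIn-∨ : ∀ f g p m → countIn (λ x → f x ∨ g x) p m ≤ countIn f p m + countIn g p m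
  countIn-∨ f g p zero = z≤n
  countIn-∨ f g p (suc m) with f p | g p
  ... | true | true = s≤s (≤-trans (countIn-∨ f g (suc p) m) (≤-trans (m≤n⇒m≤1+n ≤-refl) (≤-reflexive (sym (+-suc _ _)))))
  ... | true | false = s≤s (countIn-∨ f g (suc p) m)
  ... | false | true = ≤-trans (s≤s (countIn-∨ f g (suc p) m)) (≤-reflexive (sym (+-suc _ _)))
  ... | false | false = countIn-∨ f g (suc p) m

  countIn-≡ᵇ-above : ∀ s p m → s < p → countIn (_≡ᵇ s) p m ≡ 0
  countIn-≡ᵇ-above s p zero _ = refl
  countIn-≡ᵇ-above s p (suc m) s<p with p ≡ᵇ s in p≡ᵇs
  ... | true = contradiction (≡ᵇ⇒≡ p s (Equivalence.from T-≡ p≡ᵇs)) (>⇒≢ s<p)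
  ... | false = countIn-≡ᵇ-above s (suc p) m (m≤n⇒m≤1+n s<p)

  countIn-≡ᵇ : ∀ s p m → countIn (_≡ᵇ s) p m ≤ 1
  countIn-≡ᵇ s p zero = z≤n
  countIn-≡ᵇ s p (suc m) with p ≡ᵇ s in p≡ᵇs
  ... | true =
    s≤s (≤-reflexive (countIn-≡ᵇ-above s (suc p) m (s≤s (≤-reflexive (sym (≡ᵇ⇒≡ p s (Equivalence.from T-≡ p≡ᵇs)))))))
  ... | false = countIn-≡ᵇ s (suc p) m

  countIn-∈ᵇ : ∀ S p m → countIn (_∈ᵇ S) p m ≤ length S
  countIn-∈ᵇ [] p m = ≤-reflexive (countIn-∈ᵇ[] p m)
    where
    countIn-∈ᵇ[] : ∀ p m → countIn (_∈ᵇ []) p m ≡ 0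
    countIn-∈ᵇ[] p zero = refl
    countIn-∈ᵇ[] p (suc m) = countIn-∈ᵇ[] (suc p) m
  countIn-∈ᵇ (s ∷ S) p m =
    ≤-trans (countIn-∨ (_≡ᵇ s) (_∈ᵇ S) p m) (+-mono-≤ (countIn-≡ᵇ s p m) (countIn-∈ᵇ S p m))

  module Density (u : ℕ → Bool) where

    ones zeros : ℕ → ℕ → ℕ
    ones = countIn u
    zeros = countIn (not ∘ u)

    short-window : ∀ p {m} c → m ≤ c → ones p m ≤ c + zeros p m
    short-window p {m} c m≤c = ≤-trans (countIn-≤ u p m) (≤-trans m≤c (m≤m+n c _))

    module Avoiding (lo E : ℕ)
      (no-11∙1 : ∀ b → lo ≤ b → 3 + b < E → u b ≡ true → u (1 + b) ≡ true → u (3 + b) ≡ true → ⊥)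
      (no-1∙11 : ∀ b → lo ≤ b → 3 + b < E → u b ≡ true → u (2 + b) ≡ true → u (3 + b) ≡ true → ⊥)
      (no-111∙∙11 : ∀ x → lo ≤ x → 6 + x < E →
        u x ≡ true → u (1 + x) ≡ true → u (2 + x) ≡ true → u (5 + x) ≡ true → u (6 + x) ≡ true → ⊥)
      where

      shift-window : ∀ p k m → p + (k + m) ≡ E → (k + p) + m ≡ E
      shift-window p k m e = trans (trans (cong (_+ m) (+-comm k p)) (+-assoc p k m)) e

      in-window : ∀ p k m → p + (suc k + m) ≡ E → k + p < E
      in-window p k m e = subst (k + p <_) e (subst (_< p + (suc k + m)) (+-comm p k) (+-monoʳ-< p (s≤s (m≤m+n k m))))

      -- Read from the left, the window splits into blocks 0, 10, 1100 and 11100, the last followed by a window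
      -- that by 111··11 does not start with 11; the pattern 11·1 excludes every other beginning.
      mutual
        ones≤6+zeros : ∀ p m → p + m ≡ E → lo ≤ p → ones p m ≤ 6 + zeros p m
        ones≤6+zeros p 0 _ _ = short-window p 6 z≤n
        ones≤6+zeros p 1 _ _ = short-window p 6 (≤ᵇ⇒≤ 1 6 _)
        ones≤6+zeros p 2 _ _ = short-window p 6 (≤ᵇ⇒≤ 2 6 _)
        ones≤6+zeros p 3 _ _ = short-window p 6 (≤ᵇ⇒≤ 3 6 _)
        ones≤6+zeros p 4 _ _ = short-window p 6 (≤ᵇ⇒≤ 4 6 _)
        ones≤6+zeros p 5 _ _ = short-window p 6 (≤ᵇ⇒≤ 5 6 _)
        ones≤6+zeros p 6 _ _ = short-window p 6 ≤-refl
        ones≤6+zeros p (suc (suc (suc (suc (suc (suc (suc m))))))) e lo≤p with u p in u₀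
        ... | false = m≤n⇒m≤1+n (ones≤6+zeros (1 + p) _ (shift-window p 1 _ e) (m≤n⇒m≤1+n lo≤p))
        ... | true with u (1 + p) in u₁
        ... | false = s≤s (ones≤6+zeros (2 + p) _ (shift-window p 2 _ e) (≤-trans lo≤p (m≤n+m p 2)))
        ... | true with u (2 + p) in u₂ | u (3 + p) in u₃
        ... | _ | true = ⊥-elim (no-11∙1 p lo≤p (in-window p 3 _ e) u₀ u₁ u₃)
        ... | false | false = s≤s (s≤s (ones≤6+zeros (4 + p) _ (shift-window p 4 _ e) (≤-trans lo≤p (m≤n+m p 4))))
        ... | true | false with u (4 + p) in u₄
        ... | true = ⊥-elim (no-11∙1 (1 + p) (m≤n⇒m≤1+n lo≤p) (in-window p 4 _ e) u₁ u₂ u₄)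
        ... | false = s≤s (s≤s (s≤s (ones≤5+zeros (5 + p) _ (shift-window p 5 _ e) (≤-trans lo≤p (m≤n+m p 5))
                        (no-111∙∙11 p lo≤p (in-window p 6 _ e) u₀ u₁ u₂))))

        ones≤5+zeros : ∀ q m → q + m ≡ E → lo ≤ q → (u q ≡ true → u (1 + q) ≡ true → ⊥) →
          ones q m ≤ 5 + zeros q m
        ones≤5+zeros q 0 _ _ _ = short-window q 5 z≤n
        ones≤5+zeros q 1 _ _ _ = short-window q 5 (≤ᵇ⇒≤ 1 5 _)
        ones≤5+zeros q 2 _ _ _ = short-window q 5 (≤ᵇ⇒≤ 2 5 _)
        ones≤5+zeros q 3 _ _ _ = short-window q 5 (≤ᵇ⇒≤ 3 5 _)
        ones≤5+zeros q 4 _ _ _ = short-window q 5 (≤ᵇ⇒≤ 4 5 _)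
        ones≤5+zeros q 5 _ _ _ = short-window q 5 ≤-refl
        ones≤5+zeros q (suc (suc (suc (suc (suc (suc m)))))) e lo≤q no-11 with u q in u₀
        ... | false = ones≤6+zeros (1 + q) _ (shift-window q 1 _ e) (m≤n⇒m≤1+n lo≤q)
        ... | true with u (1 + q) in u₁
        ... | true = ⊥-elim (no-11 refl refl)
        ... | false = s≤s (ones≤5+zeros (2 + q) _ (shift-window q 2 _ e) (≤-trans lo≤q (m≤n+m q 2))
                        (no-1∙11 q lo≤q (in-window q 3 _ e) u₀))

    module AvoidingAfterPair (K E : ℕ)
      (no-11⋯11∙1 : ∀ a b → 1 ≤ a → K + a ≤ b → 3 + b < E →
        u a ≡ true → u (1 + a) ≡ true → u b ≡ true → u (1 + b) ≡ true → u (3 + b) ≡ true → ⊥)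
      (no-11⋯1∙11 : ∀ a b → 1 ≤ a → K + a ≤ b → 3 + b < E →
        u a ≡ true → u (1 + a) ≡ true → u b ≡ true → u (2 + b) ≡ true → u (3 + b) ≡ true → ⊥)
      (no-111∙∙11 : ∀ x → 1 ≤ x → 6 + x < E →
        u x ≡ true → u (1 + x) ≡ true → u (2 + x) ≡ true → u (5 + x) ≡ true → u (6 + x) ≡ true → ⊥)
      where

      ones≤zeros+[K+6]-from-pair : ∀ p m → p + m ≡ E → 1 ≤ p → u p ≡ true → u (1 + p) ≡ true →
        ones p m ≤ zeros p m + (K + 6)
      ones≤zeros+[K+6]-from-pair p m e 1≤p u₀ u₁ with K ≤? m
      ... | no m≱K =
        ≤-trans (countIn-≤ u p m) (≤-trans (≤-trans (<⇒≤ (≰⇒> m≱K)) (m≤m+n K 6)) (m≤n+m (K + 6) (zeros p m)))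
      ... | yes K≤m = subst (λ m → ones p m ≤ zeros p m + (K + 6)) (m+[n∸m]≡n K≤m) (begin
          ones p (K + r)                           ≡⟨ countIn-+ u p K r ⟩
          ones p K + ones (K + p) r                ≤⟨ +-mono-≤ (countIn-≤ u p K) (T.ones≤6+zeros (K + p) r e′ ≤-refl) ⟩
          K + (6 + zeros (K + p) r)                ≤⟨ rearrange ⟩
          (zeros p K + zeros (K + p) r) + (K + 6)  ≡⟨ cong (_+ (K + 6)) (countIn-+ (not ∘ u) p K r) ⟨
          zeros p (K + r) + (K + 6)                ∎)
        where
        open ≤-Reasoning
        r = m ∸ K
        e′ : (K + p) + r ≡ E
        e′ = trans (trans (cong (_+ r) (+-comm K p)) (+-assoc p K r)) (trans (cong (p +_) (m+[n∸m]≡n K≤m)) e)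
        rearrange : K + (6 + zeros (K + p) r) ≤ (zeros p K + zeros (K + p) r) + (K + 6)
        rearrange = ≤-trans (≤-reflexive (solve 2 (λ K z → K :+ (con 6 :+ z) := z :+ (K :+ con 6)) refl K (zeros (K + p) r)))
          (+-monoˡ-≤ (K + 6) (m≤n+m (zeros (K + p) r) (zeros p K)))
          where open +-*-Solver
        module T = Avoiding (K + p) E
          (λ b K+p≤b 3+b<E → no-11⋯11∙1 p b 1≤p K+p≤b 3+b<E u₀ u₁)
          (λ b K+p≤b 3+b<E → no-11⋯1∙11 p b 1≤p K+p≤b 3+b<E u₀ u₁)
          (λ x K+p≤x → no-111∙∙11 x (≤-trans 1≤p (≤-trans (m≤n+m p K) K+p≤x)))

      ones≤zeros+[K+6] : ∀ p m → p + m ≡ E → 1 ≤ p → ones p m ≤ zeros p m + (K + 6)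
      ones≤zeros+[K+6] p 0 _ _ = z≤n
      ones≤zeros+[K+6] p 1 _ _ =
        ≤-trans (countIn-≤ u p 1) (≤-trans (≤-trans (s≤s z≤n) (m≤n+m 6 K)) (m≤n+m (K + 6) (zeros p 1)))
      ones≤zeros+[K+6] p m@(suc (suc _)) e 1≤p with u p ∧ u (1 + p) in pair
      ... | true = let u₀ , u₁ = Equivalence.to T-∧ (Equivalence.from T-≡ pair) in
        ones≤zeros+[K+6]-from-pair p m e 1≤p (Equivalence.to T-≡ u₀) (Equivalence.to T-≡ u₁)
      ... | false with u p
      ...   | false = m≤n⇒m≤1+n (ones≤zeros+[K+6] (1 + p) _ (trans (sym (+-suc p _)) e) (m≤n⇒m≤1+n 1≤p))
      ...   | true with u (1 + p)
      ...     | false = s≤s (ones≤zeros+[K+6] (2 + p) _ (trans (sym (trans (+-suc p _) (cong suc (+-suc p _)))) e)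
                                  (≤-trans 1≤p (m≤n+m p 2)))
      ...     | true = contradiction pair λ ()

  -- Only nonempty facets need to be met: the vertex set, the default value in the definition of T,
  -- misses the empty facet.
  Transversal : VSet → Complex → Set
  Transversal S Δ = ∀ {F y} → F ∈ Δ → y ∈ F → ∃[ z ] z ∈ F × z ∈ S

  ∈-vertices⁺ : ∀ {Δ F y} → F ∈ Δ → y ∈ F → y ∈ vertices Δ
  ∈-vertices⁺ F∈ y∈ =
    deduplicate⁺ (T? ∘₂ _≡ᵇ_) (λ b≡ᵇa y≡a → trans y≡a (sym (≡ᵇ⇒≡ _ _ b≡ᵇa))) (∈-concat⁺′ y∈ F∈)

  ∈-vertices⁻ : ∀ {Δ y} → y ∈ vertices Δ → ∃[ F ] y ∈ F × F ∈ Δ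
  ∈-vertices⁻ {Δ} y∈ = ∈-concat⁻′ Δ (deduplicate⁻ (T? ∘₂ _≡ᵇ_) y∈)

  vertices-≤ : ∀ n Δ → VerticesIn n Δ → length (vertices Δ) ≤ n
  vertices-≤ n Δ inRange = unique-bounded⇒length≤ n (vertices Δ) (deduplicateᵇ-unique (concat Δ))
    λ y∈ → let F , y∈F , F∈ = ∈-vertices⁻ {Δ} y∈ in inRange F∈ y∈F

  T≤vertices : ∀ Δ → T Δ ≤ length (vertices Δ)
  T≤vertices Δ = foldr-⊓-≤ (length (vertices Δ)) (map length (filterᵇ (λ S → meetsAll S Δ) (subsets (vertices Δ))))

  meetsAll⇒Transversal : ∀ S Δ → IsTrue (meetsAll S Δ) → Transversal S Δ
  meetsAll⇒Transversal S Δ h {F} F∈ _ with z , z∈F , z∈ᵇS ← find (any⁻ (_∈ᵇ S) F (All.lookup (all⁺ _ Δ h) F∈)) =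
    z , z∈F , ∈ᵇ⇒∈ S z∈ᵇS

  T-attained : ∀ Δ → ∃[ S ] Transversal S Δ × T Δ ≡ length S
  T-attained Δ
    with foldr-selective ⊓-sel (length (vertices Δ)) (map length (filterᵇ (λ S → meetsAll S Δ) (subsets (vertices Δ))))
  ... | inj₁ T≡ = vertices Δ , (λ F∈ y∈ → _ , y∈ , ∈-vertices⁺ F∈ y∈) , T≡
  ... | inj₂ T∈ with S , S∈ , T≡ ← ∈-map⁻ length T∈ =
    S , meetsAll⇒Transversal S Δ (proj₂ (∈-filter⁻ (T? ∘ λ S → meetsAll S Δ) {xs = subsets (vertices Δ)} S∈)) , T≡

  module UncoveredWord (m n : ℕ) (S : VSet) (hits : Transversal S (Γ n (suc m))) where

    K : ℕ
    K = 3 + suc m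

    u : ℕ → Bool
    u x = not (x ∈ᵇ S)

    ∈S⇒covered : ∀ {z} → z ∈ S → u z ≡ true → ⊥
    ∈S⇒covered z∈S uz = T-not⁻ (Equivalence.from T-≡ uz) (∈⇒∈ᵇ z∈S)

    no-uncovered-ridge : ∀ {a b x} → ridge a b x ∈ Γ n (suc m) → a ≢ x →
      (∀ {y} → BallVertex a b y → y ≢ x → u y ≡ true) → ⊥
    no-uncovered-ridge {a} {b} {x} F∈ a≢x uncovered with z , z∈F , z∈S ← hits F∈ (∈-ridge {a} {b} a₀ a≢x) =
      ∈S⇒covered z∈S (uncovered (ballVertex (ridge⊆ballFacet a b x z∈F)) (proj₂ (∈-remove⁻ x (ballFacet a b) z∈F)))

    admissible : ∀ {a b} → 1 ≤ a → K + a ≤ b → 3 + b < suc n → Admissible n a b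
    admissible {a} 1≤a K+a≤b 3+b<1+n = 1≤a , ≤-trans (+-monoˡ-≤ a (m≤m+n 2 (1 + suc m))) K+a≤b , ≤-pred 3+b<1+n

    no-11⋯11∙1 : ∀ a b → 1 ≤ a → K + a ≤ b → 3 + b < suc n →
      u a ≡ true → u (1 + a) ≡ true → u b ≡ true → u (1 + b) ≡ true → u (3 + b) ≡ true → ⊥
    no-11⋯11∙1 a b 1≤a K+a≤b 3+b<1+n ua ua₁ ub ub₁ ub₃ =
      no-uncovered-ridge
        (interiorRidge∈Γ (suc m) (admissible 1≤a K+a≤b 3+b<1+n) b₂ (≤-trans (n<1+n b) (n≤1+n _)) (n<1+n (2 + b)) K+a≤b)
        (<⇒≢ (≤-trans (m≤n+m (suc a) 1) (≤-trans (+-monoˡ-≤ a (m≤m+n 2 (1 + suc m))) (≤-trans K+a≤b (m≤n+m b 2)))))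
        uncovered
      where
      uncovered : ∀ {y} → BallVertex a b y → y ≢ 2 + b → u y ≡ true
      uncovered a₀ _ = ua
      uncovered a₁ _ = ua₁
      uncovered b₀ _ = ub
      uncovered b₁ _ = ub₁
      uncovered b₂ y≢x = contradiction refl y≢x
      uncovered b₃ _ = ub₃

    no-11⋯1∙11 : ∀ a b → 1 ≤ a → K + a ≤ b → 3 + b < suc n →
      u a ≡ true → u (1 + a) ≡ true → u b ≡ true → u (2 + b) ≡ true → u (3 + b) ≡ true → ⊥
    no-11⋯1∙11 a b 1≤a K+a≤b 3+b<1+n ua ua₁ ub ub₂ ub₃ =
      no-uncovered-ridge
        (interiorRidge∈Γ (suc m) (admissible 1≤a K+a≤b 3+b<1+n) b₁ (n<1+n b) (≤-trans (n<1+n (1 + b)) (n≤1+n _)) K+a≤b)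
        (<⇒≢ (≤-trans (m≤n+m (suc a) 1) (≤-trans (+-monoˡ-≤ a (m≤m+n 2 (1 + suc m))) (≤-trans K+a≤b (m≤n+m b 1)))))
        uncovered
      where
      uncovered : ∀ {y} → BallVertex a b y → y ≢ 1 + b → u y ≡ true
      uncovered a₀ _ = ua
      uncovered a₁ _ = ua₁
      uncovered b₀ _ = ub
      uncovered b₁ y≢x = contradiction refl y≢x
      uncovered b₂ _ = ub₂
      uncovered b₃ _ = ub₃

    no-111∙∙11 : ∀ x → 1 ≤ x → 6 + x < suc n →
      u x ≡ true → u (1 + x) ≡ true → u (2 + x) ≡ true → u (5 + x) ≡ true → u (6 + x) ≡ true → ⊥
    no-111∙∙11 x 1≤x 6+x<1+n ux ux₁ ux₂ ux₅ ux₆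
      with z , z∈F , z∈S ← hits (flippedFacet∈Γ m 1≤x (≤-pred 6+x<1+n)) (here refl) =
      ∈S⇒covered z∈S (uncovered (flippedVertex x z∈F))
      where
      uncovered : ∀ {y} → FlippedVertex x y → u y ≡ true
      uncovered f₀ = ux
      uncovered f₁ = ux₁
      uncovered f₂ = ux₂
      uncovered f₅ = ux₅
      uncovered f₆ = ux₆

    uncovered≤covered+[K+6] : countIn u 1 n ≤ countIn (not ∘ u) 1 n + (K + 6)
    uncovered≤covered+[K+6] = Density.AvoidingAfterPair.ones≤zeros+[K+6] u K (suc n) no-11⋯11∙1 no-11⋯1∙11 no-111∙∙11 1 n refl ≤-refl

    covered≤|S| : countIn (not ∘ u) 1 n ≤ length S
    covered≤|S| = ≤-trans (countIn-mono (λ x h → trans (sym (not-involutive (x ∈ᵇ S))) h) 1 n) (countIn-∈ᵇ S 1 n)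

  transversal-bound : ∀ m {n S} → Transversal S (Γ n (suc m)) → n ≤ 2 * length S + (suc m + 9)
  transversal-bound m {n} {S} hits = begin
    n                                                    ≡⟨ countIn-partition u 1 n ⟨
    uncovered + covered                                  ≤⟨ +-monoˡ-≤ covered uncovered≤covered+[K+6] ⟩
    covered + (K + 6) + covered                          ≤⟨ +-mono-≤ (+-monoˡ-≤ (K + 6) covered≤|S|) covered≤|S| ⟩
    length S + (K + 6) + length S                        ≡⟨ rearrange (length S) (suc m) ⟩
    2 * length S + (suc m + 9)                           ∎
    where
    open ≤-Reasoning
    open +-*-Solver
    open UncoveredWord m n S hits
    rearrange : ∀ s k → s + (3 + k + 6) + s ≡ 2 * s + (k + 9)
    rearrange = solve 2 (λ s k → s :+ (con 3 :+ k :+ con 6) :+ s := con 2 :* s :+ (k :+ con 9)) refl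
    uncovered = countIn u 1 n
    covered = countIn (not ∘ u) 1 n

open import Data.Nat using (ℕ; suc; _+_; _*_; _≥_)
open import Data.Product using (∃-syntax)
open import Data.Rational using (ℚ; _<_; _≤_; _-_; 0ℚ)
open import Data.Integer using (+_)
open import Defs
open import Data.Product using (_,_)
open import Relation.Binary.PropositionalEquality using (refl; sym; subst; subst₂)
open import Relation.Nullary using (contradiction)
open import Data.List using (length)
import Data.Nat as ℕ
import Data.Nat.Properties as ℕ
import Data.Integer as ℤ
import Data.Integer.Properties as ℤ
import Data.Rational.Properties as ℚ
import Data.Rational.Unnormalised as ℚᵘ
import Data.Rational.Unnormalised.Properties as ℚᵘ
open import Data.Nat.Solver using (module +-*-Solver)
open Combinatorics using (T-attained; T≤vertices; vertices-≤; Γ-vertices; transversal-bound)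


frac-mono : ∀ a b t v → a * suc v ℕ.≤ t * suc b → frac a (suc b) ≤ frac t (suc v)
frac-mono a b t v a[1+v]≤t[1+b] =
  ℚ.toℚᵘ-cancel-≤ (ℚᵘ.≤-trans (ℚᵘ.≤-reflexive (ℚ.toℚᵘ-fromℚᵘ (ℚᵘ.mkℚᵘ (+ a) b)))
  (ℚᵘ.≤-trans (ℚᵘ.*≤* (subst₂ ℤ._≤_ (ℤ.pos-* a (suc v)) (ℤ.pos-* t (suc b)) (ℤ.+≤+ a[1+v]≤t[1+b])))
    (ℚᵘ.≤-reflexive (ℚᵘ.≃-sym (ℚ.toℚᵘ-fromℚᵘ (ℚᵘ.mkℚᵘ (+ t) v))))))

p-ε≤p : ∀ p {ε} → 0ℚ < ε → p - ε ≤ p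
p-ε≤p p 0<ε = ℚ.≤-trans (ℚ.+-monoʳ-≤ p (ℚ.neg-antimono-≤ (ℚ.<⇒≤ 0<ε))) (ℚ.≤-reflexive (ℚ.+-identityʳ p))

cross-multiplied : ∀ k t v n → (k + 5) * (k + 9) + (k + 9) ℕ.≤ n → n ℕ.≤ 2 * t + (k + 9) → v ℕ.≤ n →
  (k + 5) * v ℕ.≤ t * (2 * (k + 6))
cross-multiplied k t v n N≤n n≤2t+k+9 v≤n = begin
  (k + 5) * v                             ≤⟨ ℕ.*-monoʳ-≤ (k + 5) (ℕ.≤-trans v≤n n≤2t+k+9) ⟩
  (k + 5) * (2 * t + (k + 9))             ≡⟨ ℕ.*-distribˡ-+ (k + 5) (2 * t) (k + 9) ⟩
  (k + 5) * (2 * t) + (k + 5) * (k + 9)   ≤⟨ ℕ.+-monoʳ-≤ ((k + 5) * (2 * t)) [k+5][k+9]≤2t ⟩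
  (k + 5) * (2 * t) + 2 * t               ≡⟨ solve 2 (λ k t → (k :+ con 5) :* (con 2 :* t) :+ con 2 :* t := t :* (con 2 :* (k :+ con 6))) refl k t ⟩
  t * (2 * (k + 6))                       ∎
  where
  open ℕ.≤-Reasoning
  open +-*-Solver
  [k+5][k+9]≤2t : (k + 5) * (k + 9) ℕ.≤ 2 * t
  [k+5][k+9]≤2t = ℕ.+-cancelʳ-≤ (k + 9) _ _ (ℕ.≤-trans N≤n n≤2t+k+9)

ratio-bound : ∀ m t v n → let k = suc m in
  (k + 5) * (k + 9) + (k + 9) ℕ.≤ n → n ℕ.≤ 2 * t + (k + 9) → t ℕ.≤ v → v ℕ.≤ n →
  frac (k + 5) (2 * (k + 6)) ≤ frac t v
ratio-bound m t ℕ.zero n N≤n n≤2t+k+9 t≤0 _ with ℕ.n≤0⇒n≡0 t≤0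
... | refl = contradiction (ℕ.+-cancelʳ-≤ (suc m + 9) ((suc m + 5) * (suc m + 9)) 0 (ℕ.≤-trans N≤n n≤2t+k+9)) λ ()
ratio-bound m t (suc v) n N≤n n≤2t+k+9 _ v≤n =
  frac-mono (suc m + 5) _ t v (cross-multiplied (suc m) t (suc v) n N≤n n≤2t+k+9 v≤n)

τ-Γ-bound : ∀ m n → let k = suc m in
  (k + 5) * (k + 9) + (k + 9) ℕ.≤ n → frac (k + 5) (2 * (k + 6)) ≤ τ (Γ n k)
τ-Γ-bound m n N≤n with S , S-transversal , T≡|S| ← T-attained (Γ n (suc m)) =
  ratio-bound m (T (Γ n (suc m))) (length (vertices (Γ n (suc m)))) n N≤n
    (subst (λ t → n ℕ.≤ 2 * t + (suc m + 9)) (sym T≡|S|) (transversal-bound m S-transversal))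
    (T≤vertices (Γ n (suc m))) (vertices-≤ n (Γ n (suc m)) (Γ-vertices n (suc m)))

lemma5p10 : (k : ℕ) → k ≥ 1 → (ε : ℚ) → 0ℚ < ε →
    ∃[ N ] ((n : ℕ) → n ≥ N →
      frac (k + 5) (2 * (k + 6)) - ε ≤ τ (Γ n k))
lemma5p10 k@(suc m) _ ε 0<ε = (k + 5) * (k + 9) + (k + 9) , λ n N≤n → ℚ.≤-trans (p-ε≤p _ 0<ε) (τ-Γ-bound m n N≤n)
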